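{- Let $s,t\ge 3$ be integers, $d\in\{1,\dots,t-1\}$, $\varphi$ the cyclic $d$-shift of $C_t$, and $G=C_s\Box^{\varphi}C_t$. Let $G'$ be the spanning subgraph of $G$ obtained by deleting all edges of the form $(i,j)(i,j+1)$ (second coordinate mod $t$), i.e. the edges of the $s$ fiber cycles $F_1,\dots,F_s$. Then $G'$ has exactly $\gcd(t,d)$ connected components, these are pairwise isomorphic, and each of them is a cycle of length $st/\gcd(t,d)$.
   Context: The cycle $C_t$ has vertex set $\{1,\dots,t\}$ with $j$ adjacent to $j\pm 1$ (mod $t$). The cyclic $d$-shift of $C_t$ is the automorphism $j\mapsto j+d\pmod t$. For an automorphism $\varphi$ of $C_t$, the Cartesian graph bundle $C_s\Box^{\varphi}C_t$ is the graph with vertex set $\{(i,j):1\le i\le s,\ 1\le j\le t\}$ and edges: $(i,j)\sim(i,j+1)$ (second coordinate mod $t$) for all $i,j$; $(i,j)\sim(i+1,j)$ for $1\le i\le s-1$ and all $j$; and $(s,j)\sim(1,\varphi(j))$ for all $j$. For each $i$, the fiber cycle $F_i$ is the $t$-cycle induced on $\{(i,1),\dots,(i,t)\}$. -}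

module Defs where

open import Data.Nat using (ℕ; zero; suc; _+_; _*_; _∸_; _<_; NonZero)
open import Data.Nat.DivMod using (_%_)
open import Data.Fin using (Fin; toℕ)
open import Data.Product using (Σ; _×_; _,_; proj₁)
open import Data.Sum using (_⊎_)
open import Relation.Nullary using (¬_)
open import Relation.Binary.PropositionalEquality using (_≡_)
open import Relation.Binary.Construct.Closure.ReflexiveTransitive using (Star)
open import Function.Bundles using (_⇔_)

-- Simple (undirected) graphs given by a vertex type and an adjacency
-- relation (we always build Adj symmetric).

record Graph : Set₁ where
  field
    V   : Set
    Adj : V → V → Set
open Graph public

deleteEdges : (G : Graph) → (V G → V G → Set) → Graph
deleteEdges G Del = record { V = V G ; Adj = λ u v → Adj G u v × ¬ Del u v }

induced : (G : Graph) → (V G → Set) → Graph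
induced G P = record { V = Σ (V G) P ; Adj = λ u v → Adj G (proj₁ u) (proj₁ v) }

record _≅_ (G H : Graph) : Set where
  field
    to      : V G → V H
    from    : V H → V G
    from-to : ∀ x → from (to x) ≡ x
    to-from : ∀ y → to (from y) ≡ y
    adj     : ∀ x y → Adj G x y ⇔ Adj H (to x) (to y)

Reachable : (G : Graph) → V G → V G → Set
Reachable G = Star (Adj G)

-- G has exactly n connected components, witnessed by a component labelling
-- c : V → Fin n that is onto and identifies exactly the mutually reachable
-- vertices (so the fibres of c are precisely the connected components).
-- `component G c k` is the subgraph induced on the k-th component.
IsComponentLabelling : (G : Graph) (n : ℕ) → (V G → Fin n) → Set
IsComponentLabelling G n c =
  (∀ k → Σ (V G) λ v → c v ≡ k) ×
  (∀ u v → (c u ≡ c v) ⇔ Reachable G u v)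

component : (G : Graph) {n : ℕ} → (V G → Fin n) → Fin n → Graph
component G c k = induced G (λ v → c v ≡ k)

CycStep : (L : ℕ) → Fin L → Fin L → Set
CycStep L a b = (toℕ b ≡ suc (toℕ a)) ⊎ (suc (toℕ a) ≡ L × toℕ b ≡ 0)

Cycle : ℕ → Graph
Cycle L = record { V = Fin L ; Adj = λ a b → CycStep L a b ⊎ CycStep L b a }

-- The Cartesian graph bundle C_s □^φ C_t with φ the cyclic d-shift
-- j ↦ j + d (mod t).  Vertices (i , j) with i : Fin s, j : Fin t
-- (0-indexed, i.e. (i,j) here is (i+1,j+1) in the paper).

module _ (s t : ℕ) .{{_ : NonZero t}} (d : ℕ) where

  BVert : Set
  BVert = Fin s × Fin t

  data BStep : BVert → BVert → Set where
    fibre : ∀ {i j j'} → CycStep t j j' → BStep (i , j) (i , j')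
    rung  : ∀ {i i' j} → toℕ i' ≡ suc (toℕ i) → BStep (i , j) (i' , j)
    twist : ∀ {i i' j j'} → suc (toℕ i) ≡ s → toℕ i' ≡ 0 →
            toℕ j' ≡ (toℕ j + d) % t → BStep (i , j) (i' , j')

  Bundle : Graph
  Bundle = record { V = BVert ; Adj = λ u v → BStep u v ⊎ BStep v u }

  FibreEdge : BVert → BVert → Set
  FibreEdge (i , j) (i' , j') = i ≡ i' × (CycStep t j j' ⊎ CycStep t j' j)

  BundleMinusFibres : Graph
  BundleMinusFibres = deleteEdges Bundle FibreEdge

module Submission where

-- Without its fibre edges every vertex v of the bundle has exactly the two neighbours next v and
-- next⁻¹ v, where next (i , j) = (i + 1 , j) for i + 1 < s and next (s - 1 , j) = (0 , j + d).
-- Iterating next from (0 , k) gives orbit k n = (n mod s , k + ⌊n/s⌋·d mod t), which has period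
-- L = s·t/g for g = gcd(t , d) because t divides (t/g)·d.  For k < g and n < L these points are
-- pairwise distinct: reducing the fibre coordinate mod g recovers k, and then coprimality of
-- t/g and d/g recovers ⌊n/s⌋.  Since g·L = s·t they exhaust the vertices, so the graph is the
-- disjoint union of the g cycles orbit k 0, …, orbit k (L - 1).

open import Defs
open import Data.Nat using (ℕ; zero; suc; _+_; _*_; _∸_; _≤_; _<_; NonZero; z≤n; s≤s; z<s; ≢-nonZero; ≢-nonZero⁻¹; >-nonZero)
open import Data.Nat.Properties hiding (_≟_)
open import Data.Nat.DivMod
open import Data.Nat.Divisibility using (_∣_; divides; n∣m*n; ∣n⇒∣m*n; n∣m⇒m%n≡0; m∣n*o⇒m/n∣o)
open import Data.Nat.GCD using (gcd; gcd[m,n]≢0; gcd[m,n]∣m; gcd[m,n]∣n)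
open import Data.Nat.Coprimality using (coprime-/gcd; coprime-divisor)
open import Algebra.Properties.CommutativeSemigroup *-commutativeSemigroup using (x∙yz≈y∙xz)
open import Data.Sum using (_⊎_; inj₁; inj₂)
open import Data.Product using (Σ; _×_; _,_; proj₁; proj₂)
open import Data.Fin using (Fin; toℕ; punchOut; fromℕ<)
open import Data.Fin.Properties using (any?; _≟_; toℕ-injective; toℕ-fromℕ<; toℕ<n; fromℕ<-cong; *↔×; punchOut-injective; injective⇒≤)
open import Function.Bundles using (_↔_; Inverse; _⇔_; mk⇔; Equivalence)
open import Function.Properties.Equivalence using () renaming (sym to ⇔-sym; trans to ⇔-trans)
open import Data.Sum.Function.Propositional using (_⊎-⇔_)
open import Relation.Binary.Construct.Closure.ReflexiveTransitive using (ε; _◅_; _◅◅_; reverse)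
open import Axiom.UniquenessOfIdentityProofs using (module Decidable⇒UIP)
open import Function.Definitions using (Injective; StrictlySurjective; StrictlyInverseˡ; StrictlyInverseʳ)
open import Relation.Nullary using (¬_; yes; no; contradiction)
open import Relation.Binary.PropositionalEquality
open ≡-Reasoning

[r+q*n]%n≡r : ∀ {r n} q .{{_ : NonZero n}} → r < n → (r + q * n) % n ≡ r
[r+q*n]%n≡r {r} {n} q r<n = trans ([m+kn]%n≡m%n r q n) (m<n⇒m%n≡m r<n)

[r+q*n]/n≡q : ∀ {r n} q .{{_ : NonZero n}} → r < n → (r + q * n) / n ≡ q
[r+q*n]/n≡q {r} {n} q r<n = begin
  (r + q * n) / n   ≡⟨ +-distrib-/-∣ʳ r (n∣m*n q) ⟩
  r / n + q * n / n ≡⟨ cong₂ _+_ (m<n⇒m/n≡0 r<n) (m*n/n≡m q n) ⟩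
  q                 ∎

1+n≡1+n%m+n/m*m : ∀ n m .{{_ : NonZero m}} → suc n ≡ suc (n % m) + n / m * m
1+n≡1+n%m+n/m*m n m = cong suc (m≡m%n+[m/n]*n n m)

[1+n]%m≡1+n%m : ∀ n {m} .{{_ : NonZero m}} → suc (n % m) < m → suc n % m ≡ suc (n % m)
[1+n]%m≡1+n%m n {m} lt = trans (%-congˡ (1+n≡1+n%m+n/m*m n m)) ([r+q*n]%n≡r (n / m) lt)

[1+n]/m≡n/m : ∀ n {m} .{{_ : NonZero m}} → suc (n % m) < m → suc n / m ≡ n / m
[1+n]/m≡n/m n {m} lt = trans (/-congˡ (1+n≡1+n%m+n/m*m n m)) ([r+q*n]/n≡q (n / m) lt)

1+n≡[1+n/m]*m : ∀ n {m} .{{_ : NonZero m}} → suc (n % m) ≡ m → suc n ≡ suc (n / m) * m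
1+n≡[1+n/m]*m n {m} eq = trans (1+n≡1+n%m+n/m*m n m) (cong (_+ n / m * m) eq)

[1+n]%m≡0 : ∀ n {m} .{{_ : NonZero m}} → suc (n % m) ≡ m → suc n % m ≡ 0
[1+n]%m≡0 n {m} eq = trans (%-congˡ (1+n≡[1+n/m]*m n eq)) (m*n%n≡0 (suc (n / m)) m)

[1+n]/m≡1+n/m : ∀ n {m} .{{_ : NonZero m}} → suc (n % m) ≡ m → suc n / m ≡ suc (n / m)
[1+n]/m≡1+n/m n {m} eq = trans (/-congˡ (1+n≡[1+n/m]*m n eq)) (m*n/n≡m (suc (n / m)) m)

[m%n+o]%n≡[m+o]%n : ∀ m o n .{{_ : NonZero n}} → (m % n + o) % n ≡ (m + o) % n
[m%n+o]%n≡[m+o]%n m o n = begin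
  (m % n + o) % n         ≡⟨ %-distribˡ-+ (m % n) o n ⟩
  (m % n % n + o % n) % n ≡⟨ cong (λ r → (r + o % n) % n) (m%n%n≡m%n m n) ⟩
  (m % n + o % n) % n     ≡⟨ %-distribˡ-+ m o n ⟨
  (m + o) % n             ∎

mod-cong : ∀ {m o n} .{{_ : NonZero n}} → m % n ≡ o % n → m mod n ≡ o mod n
mod-cong eq = fromℕ<-cong _ _ eq _ _

toℕ-mod : ∀ m n .{{_ : NonZero n}} → toℕ (m mod n) ≡ m % n
toℕ-mod m n = toℕ-fromℕ< _

m%n≡o%n⇒n∣o∸m : ∀ {m n o} .{{_ : NonZero n}} → m ≤ o → m % n ≡ o % n → n ∣ o ∸ m
m%n≡o%n⇒n∣o∸m {m} {n} {o} m≤o eq = divides (o / n ∸ m / n) (begin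
  o ∸ m                                    ≡⟨ cong₂ _∸_ (m≡m%n+[m/n]*n o n) (m≡m%n+[m/n]*n m n) ⟩
  (o % n + o / n * n) ∸ (m % n + m / n * n) ≡⟨ cong (λ r → (o % n + o / n * n) ∸ (r + m / n * n)) eq ⟩
  (o % n + o / n * n) ∸ (o % n + m / n * n) ≡⟨ [m+n]∸[m+o]≡n∸o (o % n) _ _ ⟩
  o / n * n ∸ m / n * n                    ≡⟨ *-distribʳ-∸ n (o / n) (m / n) ⟨
  (o / n ∸ m / n) * n                      ∎)

module GcdQuotient (t d : ℕ) .{{_ : NonZero t}} where

  g : ℕ
  g = gcd t d

  instance
    g≢0 : NonZero g
    g≢0 = ≢-nonZero (gcd[m,n]≢0 t d (inj₁ (≢-nonZero⁻¹ t)))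

  T D : ℕ
  T = t / g
  D = d / g

  T*g≡t : T * g ≡ t
  T*g≡t = m/n*n≡m (gcd[m,n]∣m t d)

  D*g≡d : D * g ≡ d
  D*g≡d = m/n*n≡m (gcd[m,n]∣n t d)

  instance
    T≢0 : NonZero T
    T≢0 = ≢-nonZero (λ T≡0 → ≢-nonZero⁻¹ t (trans (sym T*g≡t) (cong (_* g) T≡0)))

  t∣T*d : t ∣ T * d
  t∣T*d = divides D (begin
    T * d       ≡⟨ cong (T *_) D*g≡d ⟨
    T * (D * g) ≡⟨ x∙yz≈y∙xz T D g ⟩
    D * (T * g) ≡⟨ cong (D *_) T*g≡t ⟩
    D * t       ∎)

  t∣m*d⇒T∣m : ∀ {m} → t ∣ m * d → T ∣ m
  t∣m*d⇒T∣m {m} t∣m*d = coprime-divisor (coprime-/gcd t d) (subst (T ∣_) (*-comm m D) T∣m*D)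
    where
    T∣m*D : T ∣ m * D
    T∣m*D = m∣n*o⇒m/n∣o (gcd[m,n]∣m t d) (subst (t ∣_) (trans (cong (m *_) (sym D*g≡d)) (sym (*-assoc m D g))) t∣m*d)

  offset-injective : ∀ {k k'} m m' → k < g → k' < g → (k + m * d) % t ≡ (k' + m' * d) % t → k ≡ k'
  offset-injective {k} {k'} m m' k<g k'<g eq = begin
    k                     ≡⟨ m<n⇒m%n≡m k<g ⟨
    k % g                 ≡⟨ [k+m*d]%t%g≡k%g k m ⟨
    (k + m * d) % t % g   ≡⟨ cong (_% g) eq ⟩
    (k' + m' * d) % t % g ≡⟨ [k+m*d]%t%g≡k%g k' m' ⟩
    k' % g                ≡⟨ m<n⇒m%n≡m k'<g ⟩
    k'                    ∎
    where
    [k+m*d]%t%g≡k%g : ∀ k m → (k + m * d) % t % g ≡ k % g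
    [k+m*d]%t%g≡k%g k m = trans (m∣n⇒o%n%m≡o%m g t _ (gcd[m,n]∣m t d)) (%-remove-+ʳ k (∣n⇒∣m*n m (gcd[m,n]∣n t d)))

  multiple-injective-≤ : ∀ a {m m'} → m ≤ m' → m' < T → (a + m * d) % t ≡ (a + m' * d) % t → m ≡ m'
  multiple-injective-≤ a {m} {m'} m≤m' m'<T eq = ≤-antisym m≤m' (m∸n≡0⇒m≤n m'∸m≡0)
    where
    t∣[m'∸m]*d : t ∣ (m' ∸ m) * d
    t∣[m'∸m]*d = subst (t ∣_) (trans ([m+n]∸[m+o]≡n∸o a (m' * d) (m * d)) (sym (*-distribʳ-∸ d m' m)))
                   (m%n≡o%n⇒n∣o∸m (+-monoʳ-≤ a (*-monoˡ-≤ d m≤m')) eq)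
    m'∸m<T : m' ∸ m < T
    m'∸m<T = ≤-<-trans (m∸n≤m m' m) m'<T
    m'∸m≡0 : m' ∸ m ≡ 0
    m'∸m≡0 = trans (sym (m<n⇒m%n≡m m'∸m<T)) (n∣m⇒m%n≡0 _ T (t∣m*d⇒T∣m t∣[m'∸m]*d))

  multiple-injective : ∀ a {m m'} → m < T → m' < T → (a + m * d) % t ≡ (a + m' * d) % t → m ≡ m'
  multiple-injective a {m} {m'} m<T m'<T eq with ≤-total m m'
  ... | inj₁ m≤m' = multiple-injective-≤ a m≤m' m'<T eq
  ... | inj₂ m'≤m = sym (multiple-injective-≤ a m'≤m m<T (sym eq))

injective⇒strictlySurjective : ∀ {n} {f : Fin n → Fin n} → Injective _≡_ _≡_ f → StrictlySurjective _≡_ f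
injective⇒strictlySurjective {suc n} {f} f-inj y with any? (λ x → f x ≟ y)
... | yes hit = hit
... | no  miss = contradiction (injective⇒≤ punchOut-inj) 1+n≰n
  where
  y≢f : ∀ x → y ≢ f x
  y≢f x y≡fx = miss (x , sym y≡fx)
  punchOut-inj : Injective _≡_ _≡_ (λ x → punchOut (y≢f x))
  punchOut-inj eq = f-inj (punchOut-injective (y≢f _) (y≢f _) eq)

injective⇒inverse : ∀ {n} {A B : Set} → Fin n ↔ A → Fin n ↔ B → {f : A → B} → Injective _≡_ _≡_ f →
                    Σ (B → A) λ f⁻¹ → StrictlyInverseˡ _≡_ f f⁻¹ × StrictlyInverseʳ _≡_ f f⁻¹
injective⇒inverse {A = A} {B} eA eB {f} f-inj = f⁻¹ , f∘f⁻¹ , λ a → f-inj (f∘f⁻¹ (f a))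
  where
  module eA = Inverse eA
  module eB = Inverse eB
  h : Fin _ → Fin _
  h x = eB.from (f (eA.to x))
  h-inj : Injective _≡_ _≡_ h
  h-inj {x} {y} eq = begin
    x                 ≡⟨ eA.strictlyInverseʳ x ⟨
    eA.from (eA.to x) ≡⟨ cong eA.from (f-inj (trans (sym (eB.strictlyInverseˡ _)) (trans (cong eB.to eq) (eB.strictlyInverseˡ _)))) ⟩
    eA.from (eA.to y) ≡⟨ eA.strictlyInverseʳ y ⟩
    y                 ∎
  f⁻¹ : B → A
  f⁻¹ b = eA.to (proj₁ (injective⇒strictlySurjective h-inj (eB.from b)))
  f∘f⁻¹ : StrictlyInverseˡ _≡_ f f⁻¹
  f∘f⁻¹ b = begin
    f (f⁻¹ b)             ≡⟨ eB.strictlyInverseˡ _ ⟨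
    eB.to (h x)           ≡⟨ cong eB.to (proj₂ (injective⇒strictlySurjective h-inj (eB.from b))) ⟩
    eB.to (eB.from b)     ≡⟨ eB.strictlyInverseˡ b ⟩
    b                     ∎
    where x = proj₁ (injective⇒strictlySurjective h-inj (eB.from b))

≅-sym : ∀ {G H} → G ≅ H → H ≅ G
≅-sym {G} {H} G≅H = record
  { to      = from
  ; from    = to
  ; from-to = to-from
  ; to-from = from-to
  ; adj     = λ x y → ⇔-sym (subst₂ (λ a b → Adj G (from x) (from y) ⇔ Adj H a b) (to-from x) (to-from y) (adj (from x) (from y)))
  }
  where open _≅_ G≅H

≅-trans : ∀ {G H K} → G ≅ H → H ≅ K → G ≅ K
≅-trans G≅H H≅K = record
  { to      = λ x → H≅K.to (G≅H.to x)
  ; from    = λ z → G≅H.from (H≅K.from z)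
  ; from-to = λ x → trans (cong G≅H.from (H≅K.from-to (G≅H.to x))) (G≅H.from-to x)
  ; to-from = λ z → trans (cong H≅K.to (G≅H.to-from (H≅K.from z))) (H≅K.to-from z)
  ; adj     = λ x y → ⇔-trans (G≅H.adj x y) (H≅K.adj (G≅H.to x) (G≅H.to y))
  }
  where
  module G≅H = _≅_ G≅H
  module H≅K = _≅_ H≅K

SuccAdj : {A : Set} → (A → A) → A → A → Set
SuccAdj f u v = v ≡ f u ⊎ u ≡ f v

SuccAdj-sym : ∀ {A : Set} {f : A → A} {u v} → SuccAdj f u v → SuccAdj f v u
SuccAdj-sym (inj₁ v≡fu) = inj₂ v≡fu
SuccAdj-sym (inj₂ u≡fv) = inj₁ u≡fv

sucMod : ∀ {L} .{{_ : NonZero L}} → Fin L → Fin L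
sucMod {L} a = suc (toℕ a) mod L

toℕ-sucMod : ∀ {L} .{{_ : NonZero L}} (a : Fin L) → toℕ (sucMod a) ≡ suc (toℕ a) % L
toℕ-sucMod a = toℕ-fromℕ< _

CycStep⇔≡sucMod : ∀ {L} .{{_ : NonZero L}} (a b : Fin L) → CycStep L a b ⇔ b ≡ sucMod a
CycStep⇔≡sucMod {L} a b = mk⇔ ⇒ ⇐
  where
  ⇒ : CycStep L a b → b ≡ sucMod a
  ⇒ (inj₁ b≡1+a) = toℕ-injective (begin
    toℕ b             ≡⟨ b≡1+a ⟩
    suc (toℕ a)       ≡⟨ m<n⇒m%n≡m (subst (_< L) b≡1+a (toℕ<n b)) ⟨
    suc (toℕ a) % L   ≡⟨ toℕ-sucMod a ⟨
    toℕ (sucMod a)    ∎)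
  ⇒ (inj₂ (1+a≡L , b≡0)) = toℕ-injective (begin
    toℕ b             ≡⟨ b≡0 ⟩
    0                 ≡⟨ n%n≡0 L ⟨
    L % L             ≡⟨ cong (_% L) 1+a≡L ⟨
    suc (toℕ a) % L   ≡⟨ toℕ-sucMod a ⟨
    toℕ (sucMod a)    ∎)
  ⇐ : b ≡ sucMod a → CycStep L a b
  ⇐ refl with m≤n⇒m<n∨m≡n (toℕ<n a)
  ... | inj₁ 1+a<L = inj₁ (trans (toℕ-sucMod a) (m<n⇒m%n≡m 1+a<L))
  ... | inj₂ 1+a≡L = inj₂ (1+a≡L , trans (toℕ-sucMod a) (trans (cong (_% L) 1+a≡L) (n%n≡0 L)))

Cycle-adj⇔SuccAdj : ∀ {L} .{{_ : NonZero L}} (a b : Fin L) → Adj (Cycle L) a b ⇔ SuccAdj sucMod a b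
Cycle-adj⇔SuccAdj a b = CycStep⇔≡sucMod a b ⊎-⇔ CycStep⇔≡sucMod b a

module OrbitDecomposition
  (H : Graph) (next : V H → V H) (adj⇔ : ∀ u v → Adj H u v ⇔ SuccAdj next u v)
  {g L : ℕ} .{{_ : NonZero L}} (orbit : Fin g → ℕ → V H)
  (orbit-suc : ∀ k n → next (orbit k n) ≡ orbit k (suc n))
  (orbit-mod : ∀ k n → orbit k (n % L) ≡ orbit k n)
  (position : V H → Fin g × Fin L)
  (orbit-position : ∀ v → orbit (proj₁ (position v)) (toℕ (proj₂ (position v))) ≡ v)
  (position-orbit : ∀ k p → position (orbit k (toℕ p)) ≡ (k , p))
  where

  label : V H → Fin g
  label v = proj₁ (position v)

  phase : V H → Fin L
  phase v = proj₂ (position v)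

  position-injective : ∀ {u v} → position u ≡ position v → u ≡ v
  position-injective {u} {v} eq = begin
    u                               ≡⟨ orbit-position u ⟨
    orbit (label u) (toℕ (phase u)) ≡⟨ cong (λ x → orbit (proj₁ x) (toℕ (proj₂ x))) eq ⟩
    orbit (label v) (toℕ (phase v)) ≡⟨ orbit-position v ⟩
    v                               ∎

  position-next : ∀ v → position (next v) ≡ (label v , sucMod (phase v))
  position-next v = begin
    position (next v)                    ≡⟨ cong (λ w → position (next w)) (orbit-position v) ⟨
    position (next (orbit k (toℕ p)))    ≡⟨ cong position (orbit-suc k (toℕ p)) ⟩
    position (orbit k (suc (toℕ p)))     ≡⟨ cong position (orbit-mod k (suc (toℕ p))) ⟨
    position (orbit k (suc (toℕ p) % L)) ≡⟨ cong (λ n → position (orbit k n)) (toℕ-sucMod p) ⟨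
    position (orbit k (toℕ (sucMod p)))  ≡⟨ position-orbit k (sucMod p) ⟩
    (k , sucMod p)                       ∎
    where
    k = label v
    p = phase v

  label-adj : ∀ {u v} → Adj H u v → label u ≡ label v
  label-adj {u} {v} uv with Equivalence.to (adj⇔ u v) uv
  ... | inj₁ refl = sym (cong proj₁ (position-next u))
  ... | inj₂ refl = cong proj₁ (position-next v)

  label-reachable : ∀ {u v} → Reachable H u v → label u ≡ label v
  label-reachable ε         = refl
  label-reachable (uw ◅ wv) = trans (label-adj uw) (label-reachable wv)

  adj-sym : ∀ {u v} → Adj H u v → Adj H v u
  adj-sym {u} {v} uv = Equivalence.from (adj⇔ v u) (SuccAdj-sym (Equivalence.to (adj⇔ u v) uv))

  walk-back : ∀ k n → Reachable H (orbit k n) (orbit k 0)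
  walk-back k zero    = ε
  walk-back k (suc n) = Equivalence.from (adj⇔ _ _) (inj₂ (sym (orbit-suc k n))) ◅ walk-back k n

  reachable-label : ∀ u v → label u ≡ label v → Reachable H u v
  reachable-label u v eq =
    subst₂ (Reachable H) (orbit-position u) (trans (cong (λ k → orbit k (toℕ (phase v))) eq) (orbit-position v))
      (walk-back k (toℕ (phase u)) ◅◅ reverse adj-sym (walk-back k (toℕ (phase v))))
    where k = label u

  isComponentLabelling : IsComponentLabelling H g label
  isComponentLabelling =
    (λ k → orbit k (toℕ (0 mod L)) , cong proj₁ (position-orbit k (0 mod L))) ,
    (λ u v → mk⇔ (reachable-label u v) label-reachable)

  next⇔sucMod : ∀ {u v} → label u ≡ label v → (v ≡ next u) ⇔ (phase v ≡ sucMod (phase u))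
  next⇔sucMod {u} {v} eq = mk⇔
    (λ { refl → cong proj₂ (position-next u) })
    (λ e → position-injective (trans (cong₂ _,_ (sym eq) e) (sym (position-next u))))

  component≅Cycle : ∀ k → component H label k ≅ Cycle L
  component≅Cycle k = record
    { to      = λ x → phase (proj₁ x)
    ; from    = λ p → orbit k (toℕ p) , cong proj₁ (position-orbit k p)
    ; from-to = λ (v , v∈k) → member-≡ (trans (cong (λ k → orbit k (toℕ (phase v))) (sym v∈k)) (orbit-position v))
    ; to-from = λ p → cong proj₂ (position-orbit k p)
    ; adj     = λ (u , u∈k) (v , v∈k) → let eq = trans u∈k (sym v∈k) in
        ⇔-trans (adj⇔ u v) (⇔-trans (next⇔sucMod eq ⊎-⇔ next⇔sucMod (sym eq)) (⇔-sym (Cycle-adj⇔SuccAdj (phase u) (phase v))))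
    }
    where
    member-≡ : ∀ {u v} {u∈k : label u ≡ k} {v∈k : label v ≡ k} → u ≡ v →
               _≡_ {A = V (component H label k)} (u , u∈k) (v , v∈k)
    member-≡ refl = cong (_ ,_) (Decidable⇒UIP.≡-irrelevant _≟_ _ _)

module BundleOrbits (s t d : ℕ) .{{_ : NonZero t}} (1<s : 1 < s) where

  open GcdQuotient t d

  0<s : 0 < s
  0<s = <-trans z<s 1<s

  instance
    s≢0 : NonZero s
    s≢0 = >-nonZero 0<s

  X : Set
  X = BVert s t d

  G' : Graph
  G' = BundleMinusFibres s t d

  next : X → X
  next (i , j) with m≤n⇒m<n∨m≡n (toℕ<n i)
  ... | inj₁ 1+i<s = fromℕ< 1+i<s , j
  ... | inj₂ _     = fromℕ< 0<s , (toℕ j + d) mod t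

  next-BStep : ∀ u → BStep s t d u (next u)
  next-BStep (i , j) with m≤n⇒m<n∨m≡n (toℕ<n i)
  ... | inj₁ 1+i<s = rung (toℕ-fromℕ< 1+i<s)
  ... | inj₂ 1+i≡s = twist 1+i≡s (toℕ-fromℕ< 0<s) (toℕ-mod _ t)

  next-layer≢ : ∀ u → proj₁ (next u) ≢ proj₁ u
  next-layer≢ (i , j) with m≤n⇒m<n∨m≡n (toℕ<n i)
  ... | inj₁ 1+i<s = λ eq → 1+n≢n (trans (sym (toℕ-fromℕ< 1+i<s)) (cong toℕ eq))
  ... | inj₂ 1+i≡s = λ eq → <-irrefl (trans (cong suc (trans (sym (toℕ-fromℕ< 0<s)) (cong toℕ eq))) 1+i≡s) 1<s

  BStep⇒FibreEdge⊎next : ∀ {u v} → BStep s t d u v → FibreEdge s t d u v ⊎ v ≡ next u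
  BStep⇒FibreEdge⊎next (fibre step) = inj₁ (refl , inj₁ step)
  BStep⇒FibreEdge⊎next {i , j} {i' , .j} (rung i'≡1+i) with m≤n⇒m<n∨m≡n (toℕ<n i)
  ... | inj₁ 1+i<s = inj₂ (cong (_, j) (toℕ-injective (trans i'≡1+i (sym (toℕ-fromℕ< 1+i<s)))))
  ... | inj₂ 1+i≡s = contradiction (toℕ<n i') (<-irrefl (trans i'≡1+i 1+i≡s))
  BStep⇒FibreEdge⊎next {i , j} (twist 1+i≡s i'≡0 j'≡j+d) with m≤n⇒m<n∨m≡n (toℕ<n i)
  ... | inj₁ 1+i<s = contradiction 1+i<s (<-irrefl 1+i≡s)
  ... | inj₂ _     = inj₂ (cong₂ _,_ (toℕ-injective (trans i'≡0 (sym (toℕ-fromℕ< 0<s))))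
                                     (toℕ-injective (trans j'≡j+d (sym (toℕ-mod _ t)))))

  FibreEdge-sym : ∀ {u v} → FibreEdge s t d u v → FibreEdge s t d v u
  FibreEdge-sym (refl , inj₁ step) = refl , inj₂ step
  FibreEdge-sym (refl , inj₂ step) = refl , inj₁ step

  next-¬FibreEdge : ∀ u → ¬ FibreEdge s t d u (next u)
  next-¬FibreEdge u (same-layer , _) = next-layer≢ u (sym same-layer)

  adj⇔SuccAdj : ∀ u v → Adj G' u v ⇔ SuccAdj next u v
  adj⇔SuccAdj u v = mk⇔ ⇒ ⇐
    where
    ⇒ : Adj G' u v → SuccAdj next u v
    ⇒ (inj₁ uv , ¬fibre) with BStep⇒FibreEdge⊎next uv
    ... | inj₁ uv-fibre = contradiction uv-fibre ¬fibre
    ... | inj₂ v≡next   = inj₁ v≡next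
    ⇒ (inj₂ vu , ¬fibre) with BStep⇒FibreEdge⊎next vu
    ... | inj₁ vu-fibre = contradiction (FibreEdge-sym vu-fibre) ¬fibre
    ... | inj₂ u≡next   = inj₂ u≡next
    ⇐ : SuccAdj next u v → Adj G' u v
    ⇐ (inj₁ refl) = inj₁ (next-BStep u) , next-¬FibreEdge u
    ⇐ (inj₂ refl) = inj₂ (next-BStep v) , λ uv-fibre → next-¬FibreEdge v (FibreEdge-sym uv-fibre)

  L : ℕ
  L = T * s

  instance
    L≢0 : NonZero L
    L≢0 = m*n≢0 T s

  orbit : ℕ → ℕ → X
  orbit k n = n mod s , (k + n / s * d) mod t

  orbit-suc : ∀ k n → next (orbit k n) ≡ orbit k (suc n)
  orbit-suc k n with m≤n⇒m<n∨m≡n (toℕ<n (n mod s))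
  ... | inj₁ 1+r<s = cong₂ _,_
    (toℕ-injective (begin
      toℕ (fromℕ< 1+r<s)   ≡⟨ toℕ-fromℕ< 1+r<s ⟩
      suc (toℕ (n mod s))  ≡⟨ cong suc (toℕ-mod n s) ⟩
      suc (n % s)          ≡⟨ [1+n]%m≡1+n%m n 1+n%s<s ⟨
      suc n % s            ≡⟨ toℕ-mod (suc n) s ⟨
      toℕ (suc n mod s)    ∎))
    (mod-cong (cong (λ q → (k + q * d) % t) (sym ([1+n]/m≡n/m n 1+n%s<s))))
    where
    1+n%s<s : suc (n % s) < s
    1+n%s<s = subst (λ r → suc r < s) (toℕ-mod n s) 1+r<s
  ... | inj₂ 1+r≡s = cong₂ _,_
    (toℕ-injective (trans (toℕ-fromℕ< 0<s) (sym (trans (toℕ-mod (suc n) s) ([1+n]%m≡0 n 1+n%s≡s)))))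
    (mod-cong (begin
      (toℕ ((k + q * d) mod t) + d) % t ≡⟨ %-congˡ (cong (_+ d) (toℕ-mod (k + q * d) t)) ⟩
      ((k + q * d) % t + d) % t         ≡⟨ [m%n+o]%n≡[m+o]%n (k + q * d) d t ⟩
      (k + q * d + d) % t               ≡⟨ %-congˡ (trans (+-assoc k (q * d) d) (cong (k +_) (+-comm (q * d) d))) ⟩
      (k + suc q * d) % t               ≡⟨ cong (λ q → (k + q * d) % t) ([1+n]/m≡1+n/m n 1+n%s≡s) ⟨
      (k + suc n / s * d) % t           ∎))
    where
    q = n / s
    1+n%s≡s : suc (n % s) ≡ s
    1+n%s≡s = trans (cong suc (sym (toℕ-mod n s))) 1+r≡s

  orbit-periodic : ∀ k n q → orbit k (n + q * L) ≡ orbit k n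
  orbit-periodic k n q = cong₂ _,_
    (mod-cong (trans (%-congˡ {o = s} n+qL≡n+qTs) ([m+kn]%n≡m%n n (q * T) s)))
    (mod-cong (begin
      (k + (n + q * L) / s * d) % t     ≡⟨ cong (λ m → (k + m * d) % t) [n+qL]/s≡n/s+qT ⟩
      (k + (n / s + q * T) * d) % t     ≡⟨ %-congˡ (cong (k +_) (*-distribʳ-+ d (n / s) (q * T))) ⟩
      (k + (n / s * d + q * T * d)) % t ≡⟨ %-congˡ (+-assoc k (n / s * d) (q * T * d)) ⟨
      (k + n / s * d + q * T * d) % t   ≡⟨ %-remove-+ʳ (k + n / s * d) (subst (t ∣_) (sym (*-assoc q T d)) (∣n⇒∣m*n q t∣T*d)) ⟩
      (k + n / s * d) % t               ∎))
    where
    n+qL≡n+qTs : n + q * L ≡ n + q * T * s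
    n+qL≡n+qTs = cong (n +_) (sym (*-assoc q T s))
    [n+qL]/s≡n/s+qT : (n + q * L) / s ≡ n / s + q * T
    [n+qL]/s≡n/s+qT = begin
      (n + q * L) / s         ≡⟨ /-congˡ {o = s} n+qL≡n+qTs ⟩
      (n + q * T * s) / s     ≡⟨ +-distrib-/-∣ʳ n {d = s} (n∣m*n (q * T)) ⟩
      n / s + q * T * s / s   ≡⟨ cong (n / s +_) (m*n/n≡m (q * T) s) ⟩
      n / s + q * T           ∎

  orbit-mod : ∀ k n → orbit k (n % L) ≡ orbit k n
  orbit-mod k n = trans (sym (orbit-periodic k (n % L) (n / L))) (cong (orbit k) (sym (m≡m%n+[m/n]*n n L)))

  orbit-injective : ∀ {k k' n n'} → k < g → k' < g → n < L → n' < L → orbit k n ≡ orbit k' n' → k ≡ k' × n ≡ n'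
  orbit-injective {k} {k'} {n} {n'} k<g k'<g n<L n'<L eq = k≡k' , n≡n'
    where
    n%s≡n'%s : n % s ≡ n' % s
    n%s≡n'%s = trans (sym (toℕ-mod n s)) (trans (cong (λ x → toℕ (proj₁ x)) eq) (toℕ-mod n' s))
    fibre-position≡ : (k + n / s * d) % t ≡ (k' + n' / s * d) % t
    fibre-position≡ = trans (sym (toℕ-mod _ t)) (trans (cong (λ x → toℕ (proj₂ x)) eq) (toℕ-mod _ t))
    k≡k' : k ≡ k'
    k≡k' = offset-injective (n / s) (n' / s) k<g k'<g fibre-position≡
    n/s≡n'/s : n / s ≡ n' / s
    n/s≡n'/s = multiple-injective k (m<n*o⇒m/o<n n<L) (m<n*o⇒m/o<n n'<L)
                 (subst (λ k' → (k + n / s * d) % t ≡ (k' + n' / s * d) % t) (sym k≡k') fibre-position≡)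
    n≡n' : n ≡ n'
    n≡n' = begin
      n                   ≡⟨ m≡m%n+[m/n]*n n s ⟩
      n % s + n / s * s   ≡⟨ cong₂ (λ r q → r + q * s) n%s≡n'%s n/s≡n'/s ⟩
      n' % s + n' / s * s ≡⟨ m≡m%n+[m/n]*n n' s ⟨
      n'                  ∎

  coordinates : Fin g × Fin L → X
  coordinates (k , p) = orbit (toℕ k) (toℕ p)

  coordinates-injective : Injective _≡_ _≡_ coordinates
  coordinates-injective {k , p} {k' , p'} eq with orbit-injective (toℕ<n k) (toℕ<n k') (toℕ<n p) (toℕ<n p') eq
  ... | k≡k' , p≡p' = cong₂ _,_ (toℕ-injective k≡k') (toℕ-injective p≡p')

  g*L≡s*t : g * L ≡ s * t
  g*L≡s*t = begin
    g * (T * s) ≡⟨ *-assoc g T s ⟨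
    g * T * s   ≡⟨ cong (_* s) (trans (*-comm g T) T*g≡t) ⟩
    t * s       ≡⟨ *-comm t s ⟩
    s * t       ∎

  coordinates⁻¹ : Σ (X → Fin g × Fin L) λ position →
                  StrictlyInverseˡ _≡_ coordinates position × StrictlyInverseʳ _≡_ coordinates position
  coordinates⁻¹ = injective⇒inverse *↔× (subst (λ n → Fin n ↔ X) (sym g*L≡s*t) *↔×) coordinates-injective

  open OrbitDecomposition G' next adj⇔SuccAdj
    (λ k → orbit (toℕ k)) (λ k → orbit-suc (toℕ k)) (λ k → orbit-mod (toℕ k))
    (proj₁ coordinates⁻¹) (proj₁ (proj₂ coordinates⁻¹)) (λ k p → proj₂ (proj₂ coordinates⁻¹) (k , p))
    public

lemma2p6 : (s t d : ℕ) .{{_ : NonZero t}} → 3 ≤ s → 3 ≤ t → 1 ≤ d → d < t →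
           Σ (V (BundleMinusFibres s t d) → Fin (gcd t d)) λ c →
             IsComponentLabelling (BundleMinusFibres s t d) (gcd t d) c ×
             (∀ k k' → component (BundleMinusFibres s t d) c k ≅ component (BundleMinusFibres s t d) c k') ×
             (∀ L → L * gcd t d ≡ s * t → ∀ k → component (BundleMinusFibres s t d) c k ≅ Cycle L)
lemma2p6 s t d 3≤s _ _ _ =
  label , isComponentLabelling ,
  (λ k k' → ≅-trans (component≅Cycle k) (≅-sym (component≅Cycle k'))) ,
  (λ L' L'*g≡s*t k → subst (λ n → component G' label k ≅ Cycle n) (sym (length-unique L'*g≡s*t)) (component≅Cycle k))
  where
  open GcdQuotient t d
  open BundleOrbits s t d (≤-trans (s≤s (s≤s z≤n)) 3≤s)
  length-unique : ∀ {L'} → L' * g ≡ s * t → L' ≡ L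
  length-unique {L'} L'*g≡s*t = *-cancelʳ-≡ L' L g (trans L'*g≡s*t (trans (sym g*L≡s*t) (*-comm g L)))
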